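{- Let $n,m\ge 1$, let $f\colon \mathbb{F}_2^n\to\mathbb{F}_2^m$ be a function and $g\colon \mathbb{F}_2^n\to\mathbb{F}_2$ a Boolean function such that $F\colon \mathbb{F}_2^n\to \mathbb{F}_2^m\oplus\mathbb{F}_2$, $F(x)=(f(x),g(x))$, is an APN $(n,m+1)$-function. Let $u$ be a nonzero element of $\mathbb{F}_2^m$. Then the function $x\mapsto f(x)+u\,g(x)$ is an APN $(n,m)$-function if and only if, for all $x,y,t\in\mathbb{F}_2^n$, the equality $f(x+t)+f(x)+f(y+t)+f(y)=u$ implies $g(x+t)+g(x)+g(y+t)+g(y)=0$.
   Context: A function $F\colon\mathbb{F}_2^n\to\mathbb{F}_2^k$ (an $(n,k)$-function) is called almost perfect nonlinear (APN) if for every nonzero $a\in\mathbb{F}_2^n$ and every $b\in\mathbb{F}_2^k$ the set $\{x\in\mathbb{F}_2^n : F(x+a)+F(x)=b\}$ has at most $2$ elements. Here $u\,g(x)$ denotes $u$ if $g(x)=1$ and $0$ if $g(x)=0$. -}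

module Defs where

open import Data.Nat using (ℕ)
open import Data.Bool using (Bool; true; false; _xor_)
open import Data.Vec using (Vec; zipWith; replicate; _++_; _∷_; [])
open import Data.Sum using (_⊎_)
open import Relation.Binary.PropositionalEquality using (_≡_)
open import Relation.Nullary using (¬_)

-- 𝔽₂ is Bool (false = 0, true = 1, addition = xor); 𝔽₂^n is Vec Bool n.
𝔽₂^ : ℕ → Set
𝔽₂^ n = Vec Bool n

_⊕_ : {n : ℕ} → 𝔽₂^ n → 𝔽₂^ n → 𝔽₂^ n
_⊕_ = zipWith _xor_

infixl 6 _⊕_

𝟎 : {n : ℕ} → 𝔽₂^ n
𝟎 {n} = replicate n false

_·_ : {m : ℕ} → 𝔽₂^ m → Bool → 𝔽₂^ m
u · true = u
u · false = 𝟎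

-- F is APN: for a ≠ 0 and every b, the set {x | F(x+a)+F(x)=b} has at most 2 elements,
-- i.e. among any three of its elements two coincide.
IsAPN : (n k : ℕ) → (𝔽₂^ n → 𝔽₂^ k) → Set
IsAPN n k F =
  (a : 𝔽₂^ n) → ¬ (a ≡ 𝟎) → (b : 𝔽₂^ k) →
  (x y z : 𝔽₂^ n) →
  F (x ⊕ a) ⊕ F x ≡ b → F (y ⊕ a) ⊕ F y ≡ b → F (z ⊕ a) ⊕ F z ≡ b →
  (x ≡ y) ⊎ (x ≡ z) ⊎ (y ≡ z)

-- F(x) = (f(x), g(x)) ∈ 𝔽₂^m ⊕ 𝔽₂ ≅ 𝔽₂^(m+1) (last coordinate is g)
pairFn : {n m : ℕ} → (𝔽₂^ n → 𝔽₂^ m) → (𝔽₂^ n → Bool) → 𝔽₂^ n → 𝔽₂^ (m Data.Nat.+ 1)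
pairFn f g x = f x ++ (g x ∷ [])

-- Write Δ F a x = F (x + a) + F x. A function is APN iff, for every a ≠ 0,
-- Δ F a x = Δ F a y forces y ∈ {x, x + a}. For h = f + u g we have
-- Δ h a = Δ f a + u Δ g a, and the map (X, α) ↦ X + u α has kernel {(0, 0), (u, 1)}.
-- So Δ h a x = Δ h a y holds iff either Δ F a x = Δ F a y, or
-- Δ f a x + Δ f a y = u while Δ g a x ≠ Δ g a y. The condition excludes exactly the
-- second alternative, so under it h inherits APN-ness from F. Conversely, a violation
-- gives a collision of Δ h t outside {x, x + t}: on such a pair Δ f t would agree,
-- contradicting Δ f t x + Δ f t y = u ≠ 0.
module Submission where

open import Defs
open import Algebra.Bundles using (AbelianGroup)
open import Algebra.Structures using (IsAbelianGroup)
open import Data.Bool using (Bool; true; false; _xor_)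
open import Data.Bool.Properties
  using (xor-assoc; xor-comm; xor-identityˡ; xor-identityʳ; xor-same; ¬-not)
open import Data.Nat using (ℕ; _+_; _≥_)
open import Data.Product using (_×_; _,_; uncurry)
open import Data.Sum using (_⊎_; inj₁; inj₂)
open import Data.Vec using (_∷_; []; _++_)
open import Data.Vec.Properties using (zipWith-++)
open import Data.Vec.Relation.Binary.Pointwise.Inductive
  using (Pointwise-≡⇒≡; zipWith-assoc; zipWith-comm; zipWith-identityˡ; zipWith-identityʳ)
open import Function using (id)
open import Function.Bundles using (_⇔_; mk⇔; Equivalence)
open import Level using (0ℓ)
open import Relation.Binary.PropositionalEquality
  using (_≡_; refl; sym; trans; cong; cong₂; subst; module ≡-Reasoning)
open import Relation.Binary.PropositionalEquality.Algebra using (isMagma)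
open import Relation.Nullary using (¬_; contradiction)
import Algebra.Properties.AbelianGroup as AbelianGroupProperties
import Algebra.Properties.CommutativeSemigroup as CommutativeSemigroupProperties

open ≡-Reasoning
open Equivalence using (to; from)

⊕-self : ∀ {n} (x : 𝔽₂^ n) → x ⊕ x ≡ 𝟎
⊕-self []      = refl
⊕-self (b ∷ x) = cong₂ _∷_ (xor-same b) (⊕-self x)

⊕-isAbelianGroup : ∀ {n} → IsAbelianGroup _≡_ (_⊕_ {n}) 𝟎 id
⊕-isAbelianGroup = record
  { isGroup = record
    { isMonoid = record
      { isSemigroup = record
        { isMagma = isMagma _⊕_
        ; assoc   = λ x y z → Pointwise-≡⇒≡ (zipWith-assoc xor-assoc x y z)
        }
      ; identity = (λ x → Pointwise-≡⇒≡ (zipWith-identityˡ xor-identityˡ x))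
                 , (λ x → Pointwise-≡⇒≡ (zipWith-identityʳ xor-identityʳ x))
      }
    ; inverse = ⊕-self , ⊕-self
    ; ⁻¹-cong = cong id
    }
  ; comm = λ x y → Pointwise-≡⇒≡ (zipWith-comm xor-comm x y)
  }

⊕-abelianGroup : ℕ → AbelianGroup 0ℓ 0ℓ
⊕-abelianGroup n = record { isAbelianGroup = ⊕-isAbelianGroup {n} }

module ⊕ {n : ℕ} where
  open AbelianGroup (⊕-abelianGroup n) public
  open AbelianGroupProperties (⊕-abelianGroup n) public
  open CommutativeSemigroupProperties commutativeSemigroup public

⊕-exchange : ∀ {n} {a b c d : 𝔽₂^ n} → a ⊕ b ≡ c ⊕ d → a ⊕ c ≡ b ⊕ d
⊕-exchange {a = a} {b} {c} {d} a⊕b≡c⊕d = ⊕.x∙y⁻¹≈ε⇒x≈y (a ⊕ c) (b ⊕ d) (begin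
  (a ⊕ c) ⊕ (b ⊕ d)  ≡⟨ ⊕.interchange a c b d ⟩
  (a ⊕ b) ⊕ (c ⊕ d)  ≡⟨ cong (_⊕ (c ⊕ d)) a⊕b≡c⊕d ⟩
  (c ⊕ d) ⊕ (c ⊕ d)  ≡⟨ ⊕-self (c ⊕ d) ⟩
  𝟎                  ∎)

x≡x⊕a⇒a≡𝟎 : ∀ {n} {x a : 𝔽₂^ n} → x ≡ x ⊕ a → a ≡ 𝟎
x≡x⊕a⇒a≡𝟎 {x = x} {a} x≡x⊕a = ⊕.∙-cancelˡ x a 𝟎 (trans (sym x≡x⊕a) (sym (⊕.identityʳ x)))

xor≡false⇒≡ : ∀ {α β : Bool} → α xor β ≡ false → α ≡ β
xor≡false⇒≡ {false} {false} _ = refl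
xor≡false⇒≡ {true}  {true}  _ = refl

·-distrib-xor : ∀ {m} (u : 𝔽₂^ m) (α β : Bool) → u · α ⊕ u · β ≡ u · (α xor β)
·-distrib-xor u true  true  = ⊕-self u
·-distrib-xor u true  false = ⊕.identityʳ u
·-distrib-xor u false true  = ⊕.identityˡ u
·-distrib-xor u false false = ⊕-self 𝟎

-- The map (X, α) ↦ X ⊕ u · α has kernel {(𝟎, false), (u, true)}.
⊕·-cancel : ∀ {m} {u X Y : 𝔽₂^ m} {α β : Bool} →
            (X ⊕ Y ≡ u → α xor β ≡ false) →
            X ⊕ u · α ≡ Y ⊕ u · β → X ≡ Y × α ≡ β
⊕·-cancel {u = u} {X} {Y} {α} {β} kernel-trivial eq
  with α xor β in αβ | trans (⊕-exchange eq) (·-distrib-xor u α β)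
... | false | X⊕Y≡𝟎 = ⊕.x∙y⁻¹≈ε⇒x≈y X Y X⊕Y≡𝟎 , xor≡false⇒≡ αβ
... | true  | X⊕Y≡u with () ← kernel-trivial X⊕Y≡u

⊕·-collide : ∀ {m} {u X Y : 𝔽₂^ m} {α β : Bool} →
             X ⊕ Y ≡ u → α xor β ≡ true → X ⊕ u · α ≡ Y ⊕ u · β
⊕·-collide {u = u} {X} {Y} {α} {β} X⊕Y≡u αβ≡true = ⊕-exchange (begin
  X ⊕ Y          ≡⟨ X⊕Y≡u ⟩
  u              ≡⟨ cong (u ·_) (sym αβ≡true) ⟩
  u · (α xor β)  ≡⟨ ·-distrib-xor u α β ⟨
  u · α ⊕ u · β  ∎)

Δ : ∀ {n k} → (𝔽₂^ n → 𝔽₂^ k) → 𝔽₂^ n → 𝔽₂^ n → 𝔽₂^ k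
Δ F a x = F (x ⊕ a) ⊕ F x

Δᵇ : ∀ {n} → (𝔽₂^ n → Bool) → 𝔽₂^ n → 𝔽₂^ n → Bool
Δᵇ g a x = g (x ⊕ a) xor g x

Δ-𝟎 : ∀ {n k} (F : 𝔽₂^ n → 𝔽₂^ k) (x : 𝔽₂^ n) → Δ F 𝟎 x ≡ 𝟎
Δ-𝟎 F x = trans (cong (λ y → F y ⊕ F x) (⊕.identityʳ x)) (⊕-self (F x))

Δ-shift : ∀ {n k} (F : 𝔽₂^ n → 𝔽₂^ k) (a x : 𝔽₂^ n) → Δ F a (x ⊕ a) ≡ Δ F a x
Δ-shift F a x = begin
  F (x ⊕ a ⊕ a) ⊕ F (x ⊕ a)  ≡⟨ cong (λ y → F y ⊕ F (x ⊕ a)) (⊕.//-rightDividesʳ a x) ⟩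
  F x ⊕ F (x ⊕ a)            ≡⟨ ⊕.comm (F x) (F (x ⊕ a)) ⟩
  Δ F a x                    ∎

Δ-pair : ∀ {n k} (F : 𝔽₂^ n → 𝔽₂^ k) {a x y : 𝔽₂^ n} →
         x ≡ y ⊎ y ≡ x ⊕ a → Δ F a x ≡ Δ F a y
Δ-pair F         (inj₁ refl) = refl
Δ-pair F {a} {x} (inj₂ refl) = sym (Δ-shift F a x)

switch : ∀ {n m} → (𝔽₂^ n → 𝔽₂^ m) → (𝔽₂^ n → Bool) → 𝔽₂^ m → 𝔽₂^ n → 𝔽₂^ m
switch f g u x = f x ⊕ u · g x

Δ-switch : ∀ {n m} (f : 𝔽₂^ n → 𝔽₂^ m) (g : 𝔽₂^ n → Bool) (u : 𝔽₂^ m) (a x : 𝔽₂^ n) →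
           Δ (switch f g u) a x ≡ Δ f a x ⊕ u · Δᵇ g a x
Δ-switch f g u a x = begin
  (f (x ⊕ a) ⊕ u · g (x ⊕ a)) ⊕ (f x ⊕ u · g x)
    ≡⟨ ⊕.interchange (f (x ⊕ a)) (u · g (x ⊕ a)) (f x) (u · g x) ⟩
  Δ f a x ⊕ (u · g (x ⊕ a) ⊕ u · g x)
    ≡⟨ cong (Δ f a x ⊕_) (·-distrib-xor u (g (x ⊕ a)) (g x)) ⟩
  Δ f a x ⊕ u · Δᵇ g a x
    ∎

Δ-pairFn : ∀ {n m} (f : 𝔽₂^ n → 𝔽₂^ m) (g : 𝔽₂^ n → Bool) (a x : 𝔽₂^ n) →
           Δ (pairFn f g) a x ≡ Δ f a x ++ (Δᵇ g a x ∷ [])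
Δ-pairFn f g a x = zipWith-++ _xor_ (f (x ⊕ a)) (g (x ⊕ a) ∷ []) (f x) (g x ∷ [])

PairedDerivatives : ∀ {n k} → (𝔽₂^ n → 𝔽₂^ k) → Set
PairedDerivatives {n} F =
  (a : 𝔽₂^ n) → ¬ (a ≡ 𝟎) → (x y : 𝔽₂^ n) → Δ F a x ≡ Δ F a y → x ≡ y ⊎ y ≡ x ⊕ a

IsAPN⇒PairedDerivatives : ∀ {n k} {F : 𝔽₂^ n → 𝔽₂^ k} → IsAPN n k F → PairedDerivatives F
IsAPN⇒PairedDerivatives {F = F} apn a a≢𝟎 x y Δx≡Δy
  with apn a a≢𝟎 (Δ F a x) x y (x ⊕ a) refl (sym Δx≡Δy) (Δ-shift F a x)
... | inj₁ x≡y          = inj₁ x≡y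
... | inj₂ (inj₁ x≡x⊕a) = contradiction (x≡x⊕a⇒a≡𝟎 x≡x⊕a) a≢𝟎
... | inj₂ (inj₂ y≡x⊕a) = inj₂ y≡x⊕a

PairedDerivatives⇒IsAPN : ∀ {n k} {F : 𝔽₂^ n → 𝔽₂^ k} → PairedDerivatives F → IsAPN n k F
PairedDerivatives⇒IsAPN paired a a≢𝟎 b x y z Δx≡b Δy≡b Δz≡b
  with paired a a≢𝟎 x y (trans Δx≡b (sym Δy≡b)) | paired a a≢𝟎 x z (trans Δx≡b (sym Δz≡b))
... | inj₁ x≡y   | _          = inj₁ x≡y
... | inj₂ _     | inj₁ x≡z   = inj₂ (inj₁ x≡z)
... | inj₂ y≡x⊕a | inj₂ z≡x⊕a = inj₂ (inj₂ (trans y≡x⊕a (sym z≡x⊕a)))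

SwitchingCondition : ∀ {n m} → (𝔽₂^ n → 𝔽₂^ m) → (𝔽₂^ n → Bool) → 𝔽₂^ m → Set
SwitchingCondition {n} f g u =
  (x y t : 𝔽₂^ n) → Δ f t x ⊕ Δ f t y ≡ u → Δᵇ g t x xor Δᵇ g t y ≡ false

switchingCondition⇔ : ∀ {n m} (f : 𝔽₂^ n → 𝔽₂^ m) (g : 𝔽₂^ n → Bool) (u : 𝔽₂^ m) →
  SwitchingCondition f g u ⇔
    ((x y t : 𝔽₂^ n) →
      f (x ⊕ t) ⊕ f x ⊕ f (y ⊕ t) ⊕ f y ≡ u →
      (g (x ⊕ t) xor g x xor g (y ⊕ t) xor g y) ≡ false)
switchingCondition⇔ f g u = mk⇔
  (λ cond x y t eq →
    trans (sym (xor-assoc (g (x ⊕ t)) (g x) (Δᵇ g t y)))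
          (cond x y t (trans (sym (⊕.assoc (Δ f t x) (f (y ⊕ t)) (f y))) eq)))
  (λ cond x y t eq →
    trans (xor-assoc (g (x ⊕ t)) (g x) (Δᵇ g t y))
          (cond x y t (trans (⊕.assoc (Δ f t x) (f (y ⊕ t)) (f y)) eq)))

switch-pairedDerivatives : ∀ {n m} {f : 𝔽₂^ n → 𝔽₂^ m} {g : 𝔽₂^ n → Bool} {u : 𝔽₂^ m} →
  SwitchingCondition f g u → PairedDerivatives (pairFn f g) → PairedDerivatives (switch f g u)
switch-pairedDerivatives {f = f} {g} {u} cond paired a a≢𝟎 x y Δx≡Δy =
  paired a a≢𝟎 x y (begin
    Δ (pairFn f g) a x         ≡⟨ Δ-pairFn f g a x ⟩
    Δ f a x ++ (Δᵇ g a x ∷ [])  ≡⟨ uncurry (cong₂ (λ X α → X ++ (α ∷ []))) Δf,Δᵇg-agree ⟩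
    Δ f a y ++ (Δᵇ g a y ∷ [])  ≡⟨ Δ-pairFn f g a y ⟨
    Δ (pairFn f g) a y         ∎)
  where
  Δf,Δᵇg-agree : Δ f a x ≡ Δ f a y × Δᵇ g a x ≡ Δᵇ g a y
  Δf,Δᵇg-agree = ⊕·-cancel (cond x y a)
    (trans (sym (Δ-switch f g u a x)) (trans Δx≡Δy (Δ-switch f g u a y)))

pairedDerivatives⇒switchingCondition :
  ∀ {n m} (f : 𝔽₂^ n → 𝔽₂^ m) (g : 𝔽₂^ n → Bool) {u : 𝔽₂^ m} →
  ¬ (u ≡ 𝟎) → PairedDerivatives (switch f g u) → SwitchingCondition f g u
pairedDerivatives⇒switchingCondition f g {u} u≢𝟎 paired x y t Δfx⊕Δfy≡u =
  ¬-not λ Δᵇg-differ →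
    u≢𝟎 (Δf-agree⇒u≡𝟎 (Δ-pair f (paired t t≢𝟎 x y (Δswitch-collide Δᵇg-differ))))
  where
  Δswitch-collide : Δᵇ g t x xor Δᵇ g t y ≡ true →
                    Δ (switch f g u) t x ≡ Δ (switch f g u) t y
  Δswitch-collide Δᵇg-differ = begin
    Δ (switch f g u) t x    ≡⟨ Δ-switch f g u t x ⟩
    Δ f t x ⊕ u · Δᵇ g t x  ≡⟨ ⊕·-collide {α = Δᵇ g t x} {Δᵇ g t y} Δfx⊕Δfy≡u Δᵇg-differ ⟩
    Δ f t y ⊕ u · Δᵇ g t y  ≡⟨ Δ-switch f g u t y ⟨
    Δ (switch f g u) t y    ∎

  Δf-agree⇒u≡𝟎 : Δ f t x ≡ Δ f t y → u ≡ 𝟎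
  Δf-agree⇒u≡𝟎 Δfx≡Δfy = begin
    u                  ≡⟨ Δfx⊕Δfy≡u ⟨
    Δ f t x ⊕ Δ f t y  ≡⟨ cong (_⊕ Δ f t y) Δfx≡Δfy ⟩
    Δ f t y ⊕ Δ f t y  ≡⟨ ⊕-self (Δ f t y) ⟩
    𝟎                  ∎

  t≢𝟎 : ¬ (t ≡ 𝟎)
  t≢𝟎 t≡𝟎 = u≢𝟎 (Δf-agree⇒u≡𝟎
    (subst (λ s → Δ f s x ≡ Δ f s y) (sym t≡𝟎) (trans (Δ-𝟎 f x) (sym (Δ-𝟎 f y)))))

proposition1 : (n m : ℕ) → n ≥ 1 → m ≥ 1 →
    (f : 𝔽₂^ n → 𝔽₂^ m) → (g : 𝔽₂^ n → Bool) →
    IsAPN n (m + 1) (pairFn f g) →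
    (u : 𝔽₂^ m) → ¬ (u ≡ 𝟎) →
    IsAPN n m (λ x → f x ⊕ (u · g x)) ⇔
      ((x y t : 𝔽₂^ n) →
        f (x ⊕ t) ⊕ f x ⊕ f (y ⊕ t) ⊕ f y ≡ u →
        (g (x ⊕ t) xor g x xor g (y ⊕ t) xor g y) ≡ false)
proposition1 n m _ _ f g F-apn u u≢𝟎 = mk⇔
  (λ h-apn → to (switchingCondition⇔ f g u)
    (pairedDerivatives⇒switchingCondition f g u≢𝟎 (IsAPN⇒PairedDerivatives h-apn)))
  (λ cond → PairedDerivatives⇒IsAPN
    (switch-pairedDerivatives (from (switchingCondition⇔ f g u) cond)
      (IsAPN⇒PairedDerivatives F-apn)))
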